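{- Let $G_1$ and $G_2$ be graphs on $n$ vertices each, with disjoint vertex sets, and let $f: V(G_1)\to V(G_2)$ be a bijection. Let $G_1 \boxminus_f G_2$ be the graph with vertex set $V(G_1)\cup V(G_2)$ in which $V(G_i)$ induces $G_i$ for $i=1,2$ and the edges between $V(G_1)$ and $V(G_2)$ are exactly $\{v f(v) : v\in V(G_1)\}$. Then $\mathrm{thin}\big(\overline{G_1 \boxminus_f G_2}\big) \geq n/2$.
   Context: All graphs are finite, simple and undirected; $\overline{H}$ denotes the complement of $H$. For a graph $G=(V,E)$, an ordering $v_1,\dots,v_n$ of $V$ and a partition of $V$ into classes are consistent if for every triple $r<s<t$, whenever $v_r,v_s$ are in the same class and $v_tv_r\in E$, then $v_tv_s\in E$. The thinness $\mathrm{thin}(G)$ is the minimum $k$ such that there are an ordering of $V$ and a partition of $V$ into $k$ classes that are consistent. -}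

module Defs where

open import Level using (0ℓ)
open import Data.Nat using (ℕ; _+_; _*_; _<_; _≤_)
open import Data.Fin using (Fin)
open import Data.Sum using (_⊎_; inj₁; inj₂)
open import Data.Product using (_×_; Σ; _,_; ∃)
open import Data.Empty using (⊥)
open import Data.Unit using (⊤)
open import Relation.Nullary using (¬_; yes; no; Dec)
open import Relation.Nullary.Decidable using (_×-dec_; ¬?)
open import Relation.Binary using (Rel; Symmetric; Decidable; DecidableEquality)
open import Relation.Binary.PropositionalEquality using (_≡_; _≢_)
open import Function.Bundles using (Bijection; Func)
import Data.Fin.Properties as FinP
import Data.Sum.Properties as SumP

record Graph (V : Set) : Set₁ where
  field
    Adj    : Rel V 0ℓ
    adj-sym    : Symmetric Adj
    irrefl : ∀ {v} → ¬ Adj v v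
    dec    : Decidable Adj
open Graph public

complement : {V : Set} → DecidableEquality V → Graph V → Graph V
complement {V} _≟_ G = record
  { Adj    = λ u v → (u ≢ v) × ¬ Adj G u v
  ; adj-sym    = λ { (u≢v , ¬e) → (λ eq → u≢v (Relation.Binary.PropositionalEquality.sym eq))
                            , (λ e → ¬e (Graph.adj-sym G e)) }
  ; irrefl = λ { (u≢u , _) → u≢u _≡_.refl }
  ; dec    = λ u v → ¬? (u ≟ v) ×-dec ¬? (Graph.dec G u v)
  }

boxAdj : ∀ {n} → Graph (Fin n) → Graph (Fin n) → (Fin n → Fin n) →
         Fin n ⊎ Fin n → Fin n ⊎ Fin n → Set
boxAdj G₁ G₂ f (inj₁ u) (inj₁ v) = Adj G₁ u v
boxAdj G₁ G₂ f (inj₂ u) (inj₂ v) = Adj G₂ u v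
boxAdj G₁ G₂ f (inj₁ u) (inj₂ w) = f u ≡ w
boxAdj G₁ G₂ f (inj₂ w) (inj₁ u) = f u ≡ w

box : ∀ {n} → Graph (Fin n) → Graph (Fin n) → Bijection (FinP.≡-setoid n) (FinP.≡-setoid n) →
      Graph (Fin n ⊎ Fin n)
box {n} G₁ G₂ f = record
  { Adj    = boxAdj G₁ G₂ F
  ; adj-sym    = λ { {inj₁ u} {inj₁ v} e → Graph.adj-sym G₁ e
               ; {inj₂ u} {inj₂ v} e → Graph.adj-sym G₂ e
               ; {inj₁ u} {inj₂ v} e → e
               ; {inj₂ u} {inj₁ v} e → e }
  ; irrefl = λ { {inj₁ u} e → Graph.irrefl G₁ e ; {inj₂ u} e → Graph.irrefl G₂ e }
  ; dec    = λ { (inj₁ u) (inj₁ v) → Graph.dec G₁ u v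
               ; (inj₂ u) (inj₂ v) → Graph.dec G₂ u v
               ; (inj₁ u) (inj₂ w) → F u FinP.≟ w
               ; (inj₂ w) (inj₁ u) → F u FinP.≟ w }
  }
  where F = Bijection.to f

Ordering : (V : Set) → ℕ → Set
Ordering V N = Bijection (Relation.Binary.PropositionalEquality.setoid V) (FinP.≡-setoid N)

-- Consistency of an ordering and a partition into (at most) k classes,
-- the partition given by a class-labelling V → Fin k.
Consistent : {V : Set} {N k : ℕ} → Graph V → Ordering V N → (V → Fin k) → Set
Consistent {V} G ord cls =
  ∀ (r s t : V) → pos r Data.Fin.< pos s → pos s Data.Fin.< pos t →
    cls r ≡ cls s → Adj G t r → Adj G t s
  where pos = Bijection.to ord

HasThinness≤ : {V : Set} → (N : ℕ) → Graph V → ℕ → Set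
HasThinness≤ {V} N G k = Σ (Ordering V N) λ ord → Σ (V → Fin k) λ cls → Consistent G ord cls

-- thin(G) ≥ m/2, i.e. 2·thin(G) ≥ m: every k admitting a consistent
-- ordering/partition satisfies m ≤ 2k.
ThinAtLeastHalf : {V : Set} → (N : ℕ) → Graph V → ℕ → Set
ThinAtLeastHalf N G m = ∀ k → HasThinness≤ N G k → m ≤ 2 * k

module Submission where

-- Let H be the complement of G₁ ⊟_f G₂ and fix a
-- consistent ordering and partition of H into k classes.  For every vertex u
-- of G₁ the two matched vertices u and f(u) are non-adjacent in H, while u is
-- H-adjacent to f(v) for every v ≠ u.  Orient each matched pair by the
-- ordering: call its earlier vertex a(u), its later vertex b(u), and record
-- on which side (G₁ or G₂) a(u) lies.  If u ≠ v have the same side, a(u)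
-- before a(v) and the same class, then consistency applied to the triple
-- a(u) < a(v) < b(v) forces b(v) to be adjacent to a(v), which it is not.
-- So u ↦ (side, class of a(u)) is injective into Fin 2 × Fin k, giving
-- n ≤ 2k.

open import Defs
open import Data.Nat using (ℕ; _+_; _*_; _≤_)
open import Data.Fin using (Fin; zero; suc; _<_; combine; remQuot)
open import Data.Fin.Properties using (≡-setoid; <-cmp; <-irrefl; injective⇒≤; remQuot-combine)
open import Data.Sum using (inj₁; inj₂)
open import Data.Sum.Properties using (≡-dec; inj₁-injective; inj₂-injective)
open import Data.Product using (_×_; _,_; proj₂)
open import Data.Product.Properties using (,-injectiveˡ; ,-injectiveʳ)
open import Data.Empty using (⊥-elim)
open import Function.Bundles using (Bijection)
open import Relation.Nullary using (¬_)
open import Relation.Binary using (tri<; tri≈; tri>)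
open import Relation.Binary.PropositionalEquality using (_≡_; _≢_; refl; sym; cong; module ≡-Reasoning)
import Data.Fin.Properties as FinP

combine-injective : ∀ {s k} {i i′ : Fin s} {j j′ : Fin k} →
                    combine i j ≡ combine i′ j′ → i ≡ i′ × j ≡ j′
combine-injective {k = k} {i} {i′} {j} {j′} eq = ,-injectiveˡ pairs , ,-injectiveʳ pairs
  where
  open ≡-Reasoning
  pairs : (i , j) ≡ (i′ , j′)
  pairs = begin
    (i , j)                    ≡⟨ sym (remQuot-combine i j) ⟩
    remQuot k (combine i j)    ≡⟨ cong (remQuot k) eq ⟩
    remQuot k (combine i′ j′)  ≡⟨ remQuot-combine i′ j′ ⟩
    (i′ , j′)                  ∎

-- Two injective families x, y of vertices form a co-matching when x(u) and
-- y(v) are adjacent exactly when u ≢ v: the complement of a perfect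
-- matching between them.
record CoMatching {V : Set} (G : Graph V) (m : ℕ) : Set where
  field
    x y                 : Fin m → V
    x-injective         : ∀ {u v} → x u ≡ x v → u ≡ v
    y-injective         : ∀ {u v} → y u ≡ y v → u ≡ v
    x≢y                 : ∀ u → x u ≢ y u
    matched-nonadjacent : ∀ u → ¬ Adj G (y u) (x u)
    unmatched-adjacent  : ∀ {u v} → u ≢ v → Adj G (y v) (x u)

module ConsistentPartition {V : Set} (G : Graph V) {N k : ℕ}
  (ord : Ordering V N) (cls : V → Fin k) (cons : Consistent G ord cls) where

  pos : V → Fin N
  pos = Bijection.to ord

  pos-injective : ∀ {v w} → pos v ≡ pos w → v ≡ w
  pos-injective = Bijection.injective ord

  record SeparatedFamily (m s : ℕ) : Set where
    field
      side          : Fin m → Fin s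
      a b           : Fin m → V
      a-injective   : ∀ {i j} → side i ≡ side j → a i ≡ a j → i ≡ j
      a<b           : ∀ i → pos (a i) < pos (b i)
      b-nonadjacent : ∀ i → ¬ Adj G (b i) (a i)
      b-adjacent    : ∀ {i j} → i ≢ j → side i ≡ side j → Adj G (b j) (a i)

  module _ {m s : ℕ} (F : SeparatedFamily m s) where
    open SeparatedFamily F

    -- Two members on the same side with a(i) before a(j) lie in different
    -- classes: otherwise consistency on a(i) < a(j) < b(j) makes b(j)
    -- adjacent to a(j).
    earlier-other-class : ∀ {i j} → pos (a i) < pos (a j) → side i ≡ side j →
                          cls (a i) ≢ cls (a j)
    earlier-other-class {i} {j} ai<aj same-side same-class =
      b-nonadjacent j (cons (a i) (a j) (b j) ai<aj (a<b j) same-class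
                            (b-adjacent i≢j same-side))
      where
      i≢j : i ≢ j
      i≢j refl = <-irrefl refl ai<aj

    side-class-injective : ∀ {i j} → side i ≡ side j → cls (a i) ≡ cls (a j) → i ≡ j
    side-class-injective {i} {j} same-side same-class with <-cmp (pos (a i)) (pos (a j))
    ... | tri< ai<aj _ _ = ⊥-elim (earlier-other-class ai<aj same-side same-class)
    ... | tri≈ _ ai≡aj _ = a-injective same-side (pos-injective ai≡aj)
    ... | tri> _ _ aj<ai = ⊥-elim (earlier-other-class aj<ai (sym same-side) (sym same-class))

    separatedFamily-bound : m ≤ s * k
    separatedFamily-bound = injective⇒≤ {f = λ i → combine (side i) (cls (a i))} λ eq →
      let same-side , same-class = combine-injective eq
      in side-class-injective same-side same-class

  module _ {m : ℕ} (C : CoMatching G m) where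
    open CoMatching C

    data Orientation (u : Fin m) : Set where
      forward  : pos (x u) < pos (y u) → Orientation u
      backward : pos (y u) < pos (x u) → Orientation u

    orientation : ∀ u → Orientation u
    orientation u with <-cmp (pos (x u)) (pos (y u))
    ... | tri< xu<yu _ _ = forward xu<yu
    ... | tri≈ _ xu≡yu _ = ⊥-elim (x≢y u (pos-injective xu≡yu))
    ... | tri> _ _ yu<xu = backward yu<xu

    side : ∀ {u} → Orientation u → Fin 2
    side (forward _)  = zero
    side (backward _) = suc zero

    earlier later : ∀ {u} → Orientation u → V
    earlier {u} (forward _)  = x u
    earlier {u} (backward _) = y u
    later   {u} (forward _)  = y u
    later   {u} (backward _) = x u

    earlier-injective : ∀ {u v} (ou : Orientation u) (ov : Orientation v) →
                        side ou ≡ side ov → earlier ou ≡ earlier ov → u ≡ v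
    earlier-injective (forward _)  (forward _)  _  xu≡xv = x-injective xu≡xv
    earlier-injective (backward _) (backward _) _  yu≡yv = y-injective yu≡yv
    earlier-injective (forward _)  (backward _) () _
    earlier-injective (backward _) (forward _)  () _

    earlier<later : ∀ {u} (ou : Orientation u) → pos (earlier ou) < pos (later ou)
    earlier<later (forward xu<yu)  = xu<yu
    earlier<later (backward yu<xu) = yu<xu

    later-nonadjacent : ∀ {u} (ou : Orientation u) → ¬ Adj G (later ou) (earlier ou)
    later-nonadjacent {u} (forward _)  = matched-nonadjacent u
    later-nonadjacent {u} (backward _) = λ adj → matched-nonadjacent u (adj-sym G adj)

    later-adjacent : ∀ {u v} (ou : Orientation u) (ov : Orientation v) → u ≢ v →
                     side ou ≡ side ov → Adj G (later ov) (earlier ou)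
    later-adjacent (forward _)  (forward _)  u≢v _ = unmatched-adjacent u≢v
    later-adjacent (backward _) (backward _) u≢v _ =
      adj-sym G (unmatched-adjacent (λ v≡u → u≢v (sym v≡u)))
    later-adjacent (forward _)  (backward _) _ ()
    later-adjacent (backward _) (forward _)  _ ()

    orientedFamily : SeparatedFamily m 2
    orientedFamily = record
      { side          = λ u → side (orientation u)
      ; a             = λ u → earlier (orientation u)
      ; b             = λ u → later (orientation u)
      ; a-injective   = λ {u} {v} → earlier-injective (orientation u) (orientation v)
      ; a<b           = λ u → earlier<later (orientation u)
      ; b-nonadjacent = λ u → later-nonadjacent (orientation u)
      ; b-adjacent    = λ {u} {v} → later-adjacent (orientation u) (orientation v)
      }

    coMatching-bound : m ≤ 2 * k
    coMatching-bound = separatedFamily-bound orientedFamily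

-- In the complement of G₁ ⊟_f G₂, the vertices u of G₁ and f(u) of G₂ form a
-- co-matching, because u and f(v) are adjacent in G₁ ⊟_f G₂ exactly when u ≡ v.
box-coMatching : ∀ {n} (G₁ G₂ : Graph (Fin n)) (f : Bijection (≡-setoid n) (≡-setoid n)) →
                 CoMatching (complement (≡-dec FinP._≟_ FinP._≟_) (box G₁ G₂ f)) n
box-coMatching G₁ G₂ f = record
  { x                   = inj₁
  ; y                   = λ u → inj₂ (Bijection.to f u)
  ; x-injective         = inj₁-injective
  ; y-injective         = λ eq → Bijection.injective f (inj₂-injective eq)
  ; x≢y                 = λ _ ()
  ; matched-nonadjacent = λ _ adj → proj₂ adj refl
  ; unmatched-adjacent  = λ u≢v → (λ ()) , λ fu≡fv → u≢v (Bijection.injective f fu≡fv)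
  }

theorem3p3 : (n : ℕ) (G₁ G₂ : Graph (Fin n)) (f : Bijection (≡-setoid n) (≡-setoid n)) →
    ThinAtLeastHalf (n + n) (complement (≡-dec FinP._≟_ FinP._≟_) (box G₁ G₂ f)) n
theorem3p3 n G₁ G₂ f k (ord , cls , cons) =
  ConsistentPartition.coMatching-bound _ ord cls cons (box-coMatching G₁ G₂ f)
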